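{- Let $G$ be a group, let $S$ be a subset of $G$ with $m$ elements, and let $S=\{g_1,\dots,g_m\}=\{h_1,\dots,h_m\}$ be two orderings of $S$. Put $x_i=g_i^{ -1}h_i$ for $i\in[m]$. Then there is a permutation $\pi$ of $[m]$ such that $x_{\pi(1)}x_{\pi(2)}\cdots x_{\pi(m)}=1$. -}

module Defs where

open import Level using (Level)
open import Data.Nat using (ℕ; zero; suc)
open import Data.Fin using (Fin; zero; suc)
open import Algebra.Bundles using (Group)

prod : ∀ {c ℓ} (G : Group c ℓ) {n : ℕ} → (Fin n → Group.Carrier G) → Group.Carrier G
prod G {zero}  a = Group.ε G
prod G {suc n} a = Group._∙_ G (a zero) (prod G (λ i → a (suc i)))

-- Write h = g ∘ σ for the permutation σ matching the two orderings, so that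
-- xᵢ = gᵢ⁻¹ g_{σ i}; listing each cycle (i, σ i, σ² i, …) consecutively makes
-- the product telescope to 1. By induction, with the order starting at 0: if
-- σ fixes 0 then x₀ = 1 and 0 is dropped; otherwise, for q = σ 0,
-- x₀ x_q = g₀⁻¹ g_{σ q} is the factor x₀ of σ′ = σ ∘ (0 q), which fixes q,
-- so q is dropped from σ′ and placed right after 0.
module Submission where

open import Defs
open import Data.Nat using (ℕ; zero; suc)
open import Data.Fin using (Fin; zero; suc; punchIn)
open import Data.Fin.Properties using (_≟_; punchInᵢ≢i)
open import Data.Fin.Permutation
  using (Permutation′; _⟨$⟩ʳ_; _∘ₚ_; id; lift₀; insert; remove; transpose; permutation;
         punchIn-permute; insert-punchIn)
import Data.Fin.Permutation.Components as PC
open import Data.Product using (∃; _,_; proj₁; proj₂)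
open import Algebra.Bundles using (Group)
open import Function using (_∘_)
open import Relation.Binary.PropositionalEquality using (_≡_; _≢_; refl; sym; trans; cong)
open import Relation.Nullary using (yes; no)
open import Relation.Nullary.Decidable using (dec-true; dec-false)

transpose-matchʳ : ∀ {n} (i j : Fin n) → PC.transpose i j j ≡ i
transpose-matchʳ i j with i ≟ j
... | yes refl rewrite dec-true (i ≟ i) refl = refl
... | no i≢j rewrite dec-false (j ≟ i) (i≢j ∘ sym) | dec-true (j ≟ j) refl = refl

transpose-other : ∀ {n} (i j k : Fin n) → k ≢ i → k ≢ j → PC.transpose i j k ≡ k
transpose-other i j k k≢i k≢j rewrite dec-false (k ≟ i) k≢i | dec-false (k ≟ j) k≢j = refl

module _ {c ℓ} (G : Group c ℓ) where
  open Group G renaming (refl to ≈-refl; sym to ≈-sym; trans to ≈-trans)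
  open import Algebra.Properties.Group G using (\\-leftDividesˡ)
  open import Relation.Binary.Reasoning.Setoid setoid

  prod-cong : ∀ {n} {a b : Fin n → Carrier} → (∀ i → a i ≈ b i) → prod G a ≈ prod G b
  prod-cong {zero}  _   = ≈-refl
  prod-cong {suc n} a≈b = ∙-cong (a≈b zero) (prod-cong (a≈b ∘ suc))

  leftQuotient : ∀ {n} → (Fin n → Carrier) → Permutation′ n → Fin n → Carrier
  leftQuotient w σ i = w i ⁻¹ ∙ w (σ ⟨$⟩ʳ i)

  leftQuotient-telescope : ∀ x y z → (x ⁻¹ ∙ y) ∙ (y ⁻¹ ∙ z) ≈ x ⁻¹ ∙ z
  leftQuotient-telescope x y z = ≈-trans (assoc _ _ _) (∙-congˡ (\\-leftDividesˡ y z))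

  leftQuotient-fixed : ∀ {n} (w : Fin n → Carrier) (σ : Permutation′ n) {i} →
                       σ ⟨$⟩ʳ i ≡ i → leftQuotient w σ i ≈ ε
  leftQuotient-fixed w σ {i} σi≡i = ≈-trans (∙-congˡ (reflexive (cong w σi≡i))) (inverseˡ (w i))

  leftQuotient-remove : ∀ {n} (w : Fin (suc n) → Carrier) (σ : Permutation′ (suc n)) {q} →
                        σ ⟨$⟩ʳ q ≡ q → ∀ j →
                        leftQuotient w σ (punchIn q j) ≡ leftQuotient (w ∘ punchIn q) (remove q σ) j
  leftQuotient-remove w σ {q} σq≡q j =
    cong (λ k → w (punchIn q j) ⁻¹ ∙ w k)
         (trans (punchIn-permute σ q j) (cong (λ p → punchIn p (remove q σ ⟨$⟩ʳ j)) σq≡q))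

  mutual
    telescoping-order : ∀ n (w : Fin n → Carrier) (σ : Permutation′ n) →
                        ∃ λ (π : Permutation′ n) → prod G (leftQuotient w σ ∘ (π ⟨$⟩ʳ_)) ≈ ε
    telescoping-order zero    w σ = id , ≈-refl
    telescoping-order (suc n) w σ with rooted-telescoping-order n w σ
    ... | ρ , ∏≈ε = lift₀ ρ , ∏≈ε

    rooted-telescoping-order : ∀ n (w : Fin (suc n) → Carrier) (σ : Permutation′ (suc n)) →
                               ∃ λ (ρ : Permutation′ n) → prod G (leftQuotient w σ ∘ (lift₀ ρ ⟨$⟩ʳ_)) ≈ ε
    rooted-telescoping-order n w σ = by-image-of-zero (σ ⟨$⟩ʳ zero) refl
      where
      by-image-of-zero : ∀ q → σ ⟨$⟩ʳ zero ≡ q →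
                         ∃ λ (ρ : Permutation′ n) → prod G (leftQuotient w σ ∘ (lift₀ ρ ⟨$⟩ʳ_)) ≈ ε
      by-image-of-zero zero    σ0≡0 = rooted-telescoping-order-fixed n w σ σ0≡0
      by-image-of-zero (suc r) σ0≡q = rooted-telescoping-order-merge n w σ r σ0≡q

    rooted-telescoping-order-fixed :
      ∀ n (w : Fin (suc n) → Carrier) (σ : Permutation′ (suc n)) → σ ⟨$⟩ʳ zero ≡ zero →
      ∃ λ (ρ : Permutation′ n) → prod G (leftQuotient w σ ∘ (lift₀ ρ ⟨$⟩ʳ_)) ≈ ε
    rooted-telescoping-order-fixed n w σ σ0≡0 with telescoping-order n (w ∘ suc) (remove zero σ)
    ... | π , ∏≈ε = π , (begin
      leftQuotient w σ zero ∙ prod G (leftQuotient w σ ∘ suc ∘ (π ⟨$⟩ʳ_))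
        ≈⟨ ∙-cong (leftQuotient-fixed w σ σ0≡0)
                  (prod-cong (reflexive ∘ leftQuotient-remove w σ σ0≡0 ∘ (π ⟨$⟩ʳ_))) ⟩
      ε ∙ prod G (leftQuotient (w ∘ suc) (remove zero σ) ∘ (π ⟨$⟩ʳ_))
        ≈⟨ identityˡ _ ⟩
      prod G (leftQuotient (w ∘ suc) (remove zero σ) ∘ (π ⟨$⟩ʳ_))
        ≈⟨ ∏≈ε ⟩
      ε ∎)

    rooted-telescoping-order-merge :
      ∀ n (w : Fin (suc n) → Carrier) (σ : Permutation′ (suc n)) (r : Fin n) → σ ⟨$⟩ʳ zero ≡ suc r →
      ∃ λ (ρ : Permutation′ n) → prod G (leftQuotient w σ ∘ (lift₀ ρ ⟨$⟩ʳ_)) ≈ ε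
    rooted-telescoping-order-merge (suc n) w σ r σ0≡q
      with rooted-telescoping-order n (w ∘ punchIn (suc r)) (remove (suc r) (transpose zero (suc r) ∘ₚ σ))
    ... | ρ′ , ∏≈ε = insert zero r ρ′ , (begin
      X zero ∙ (X q ∙ prod G (X ∘ suc ∘ (insert zero r ρ′ ⟨$⟩ʳ_) ∘ suc))
        ≈⟨ ∙-congˡ (∙-congˡ (prod-cong (reflexive ∘ cong (X ∘ suc) ∘ insert-punchIn zero r ρ′))) ⟩
      X zero ∙ (X q ∙ prod G (λ k → X (punchIn q (suc (ρ′ ⟨$⟩ʳ k)))))
        ≈⟨ assoc _ _ _ ⟨
      (X zero ∙ X q) ∙ prod G (λ k → X (punchIn q (suc (ρ′ ⟨$⟩ʳ k))))
        ≈⟨ ∙-cong x₀x_q≈x₀′ (prod-cong (reflexive ∘ unmoved ∘ (ρ′ ⟨$⟩ʳ_))) ⟩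
      prod G (leftQuotient w σ′ ∘ punchIn q ∘ (lift₀ ρ′ ⟨$⟩ʳ_))
        ≈⟨ prod-cong (reflexive ∘ leftQuotient-remove w σ′ σ′q≡q ∘ (lift₀ ρ′ ⟨$⟩ʳ_)) ⟩
      prod G (leftQuotient (w ∘ punchIn q) (remove q σ′) ∘ (lift₀ ρ′ ⟨$⟩ʳ_))
        ≈⟨ ∏≈ε ⟩
      ε ∎)
      where
      q : Fin (suc (suc n))
      q = suc r

      X : Fin (suc (suc n)) → Carrier
      X = leftQuotient w σ

      σ′ : Permutation′ (suc (suc n))
      σ′ = transpose zero q ∘ₚ σ

      σ′q≡q : σ′ ⟨$⟩ʳ q ≡ q
      σ′q≡q = trans (cong (σ ⟨$⟩ʳ_) (transpose-matchʳ zero q)) σ0≡q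

      x₀x_q≈x₀′ : X zero ∙ X q ≈ leftQuotient w σ′ zero
      x₀x_q≈x₀′ = ≈-trans (∙-congʳ (∙-congˡ (reflexive (cong w σ0≡q))))
                       (leftQuotient-telescope (w zero) (w q) (w (σ ⟨$⟩ʳ q)))

      unmoved : ∀ k → X (punchIn q (suc k)) ≡ leftQuotient w σ′ (punchIn q (suc k))
      unmoved k = cong (λ i → w (punchIn q (suc k)) ⁻¹ ∙ w (σ ⟨$⟩ʳ i))
                       (sym (transpose-other zero q (punchIn q (suc k)) (λ ()) (punchInᵢ≢i q (suc k))))

  matching-permutation : ∀ {n} (g h : Fin n → Carrier) →
    (∀ i j → g i ≈ g j → i ≡ j) → (∀ i j → h i ≈ h j → i ≡ j) →
    (∀ i → ∃ λ j → g i ≈ h j) → (∀ j → ∃ λ i → h j ≈ g i) →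
    ∃ λ (σ : Permutation′ n) → ∀ j → h j ≈ g (σ ⟨$⟩ʳ j)
  matching-permutation g h g-injective h-injective g⊆h h⊆g =
    permutation to from
      (λ i → g-injective _ _ (≈-trans (≈-sym (proj₂ (h⊆g (from i)))) (≈-sym (proj₂ (g⊆h i)))))
      (λ j → h-injective _ _ (≈-trans (≈-sym (proj₂ (g⊆h (to j)))) (≈-sym (proj₂ (h⊆g j)))))
    , proj₂ ∘ h⊆g
    where
    to from : Fin _ → Fin _
    to   = proj₁ ∘ h⊆g
    from = proj₁ ∘ g⊆h

proposition3p3 : ∀ {c ℓ} (G : Group c ℓ) (m : ℕ) (g h : Fin m → Group.Carrier G) →
    (∀ i j → Group._≈_ G (g i) (g j) → i ≡ j) →
    (∀ i j → Group._≈_ G (h i) (h j) → i ≡ j) →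
    (∀ i → ∃ λ j → Group._≈_ G (g i) (h j)) →
    (∀ j → ∃ λ i → Group._≈_ G (h j) (g i)) →
    ∃ λ (π : Permutation′ m) →
      Group._≈_ G (prod G (λ k → Group._∙_ G (Group._⁻¹ G (g (π ⟨$⟩ʳ k))) (h (π ⟨$⟩ʳ k)))) (Group.ε G)
proposition3p3 G m g h g-injective h-injective g⊆h h⊆g =
  let σ , h≈g∘σ = matching-permutation G g h g-injective h-injective g⊆h h⊆g
      π , ∏≈ε   = telescoping-order G m g σ
  in  π , Group.trans G (prod-cong G (Group.∙-congˡ G ∘ h≈g∘σ ∘ (π ⟨$⟩ʳ_))) ∏≈ε
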